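{- The integrality gap of the following LP relaxation for MLVC is at least $4/3$: for a graph $G$ on $n$ vertices, with variables $u_{e,t},x_{v,t}\ge0$ for $e\in E(G)$, $v\in V(G)$, $t\in\{1,\dots,n\}$, minimize $\sum_{e,t}u_{e,t}$ subject to $\sum_v x_{v,t}\le 1$ for all $t$, and $u_{e,t}+\sum_{t'<t}x_{v,t'}\ge1$ for all $t$ and all $v,e$ with $v\in e$.
   Context: MLVC: given a graph $G$, minimize $\sum_{(u,v)\in E(G)}\max\{\pi(u),\pi(v)\}$ over bijections $\pi:V(G)\to\{1,\dots,n\}$. The integrality gap is the supremum over instances of the ratio of the MLVC optimum to the LP optimum. -}

module Defs where

open import Data.Nat as ℕ using (ℕ; zero; suc)
open import Data.Fin as Fin using (Fin; toℕ; _<?_)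
open import Data.Fin.Permutation using (Permutation′; _⟨$⟩ʳ_)
open import Data.Product using (_×_; proj₁; proj₂)
open import Data.Integer using (+_)
open import Data.Rational using (ℚ; 0ℚ; 1ℚ; _+_; _≤_; _/_)
open import Function.Definitions using (Injective)
open import Relation.Binary.PropositionalEquality using (_≡_)
open import Relation.Nullary.Decidable using (⌊_⌋)
open import Data.Bool using (if_then_else_)

record Graph : Set where
  field
    n      : ℕ
    m      : ℕ
    edge   : Fin m → Fin n × Fin n
    loopless : ∀ e → proj₁ (edge e) Fin.< proj₂ (edge e)
    noMulti  : Injective _≡_ _≡_ edge
open Graph public

sumℕ : ∀ {k} → (Fin k → ℕ) → ℕ
sumℕ {zero}  f = 0
sumℕ {suc k} f = f Fin.zero ℕ.+ sumℕ (λ i → f (Fin.suc i))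

sumℚ : ∀ {k} → (Fin k → ℚ) → ℚ
sumℚ {zero}  f = 0ℚ
sumℚ {suc k} f = f Fin.zero + sumℚ (λ i → f (Fin.suc i))

fromℕℚ : ℕ → ℚ
fromℕℚ k = + k / 1

-- Time steps t ∈ {1,…,n} are represented by Fin n (t ↦ toℕ t + 1);
-- vertex positions π(v) ∈ {1,…,n} likewise.

mlvcCost : (G : Graph) → Permutation′ (n G) → ℕ
mlvcCost G π = sumℕ (λ e →
  suc (toℕ (π ⟨$⟩ʳ proj₁ (edge G e))) ℕ.⊔ suc (toℕ (π ⟨$⟩ʳ proj₂ (edge G e))))

record LPSol (G : Graph) : Set where
  field
    x : Fin (n G) → Fin (n G) → ℚ
    u : Fin (m G) → Fin (n G) → ℚ
open LPSol public

prefixSum : (G : Graph) → LPSol G → Fin (n G) → Fin (n G) → ℚ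
prefixSum G s v t = sumℚ (λ t' → if ⌊ t' <? t ⌋ then x s v t' else 0ℚ)

record Feasible (G : Graph) (s : LPSol G) : Set where
  field
    x-nonneg : ∀ v t → 0ℚ ≤ x s v t
    u-nonneg : ∀ e t → 0ℚ ≤ u s e t
    slot     : ∀ t → sumℚ (λ v → x s v t) ≤ 1ℚ
    cover₁   : ∀ e t → 1ℚ ≤ u s e t + prefixSum G s (proj₁ (edge G e)) t
    cover₂   : ∀ e t → 1ℚ ≤ u s e t + prefixSum G s (proj₂ (edge G e)) t

lpValue : (G : Graph) → LPSol G → ℚ
lpValue G s = sumℚ (λ e → sumℚ (λ t → u s e t))

-- A single edge already exhibits the gap.  The LP may put half of each
-- endpoint into each of the two time slots: the edge then pays 1 at the first
-- slot and 1/2 at the second, 3/2 in total, whereas every ordering of the two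
-- endpoints pays max{1, 2} = 2.
module Submission where

open import Defs
open import Data.Product using (Σ; _×_; _,_)
open import Data.Integer using (+_)
open import Data.Rational using (ℚ; _≤_; _<_; _*_; _/_; 0ℚ; 1ℚ; ½; _≤?_)
open import Data.Rational.Properties using (*-monoˡ-<-pos)
open import Data.Fin using (Fin; zero; suc; toℕ)
open import Data.Fin.Permutation using (Permutation′; _⟨$⟩ʳ_; _⟨$⟩ˡ_; inverseˡ)
open import Data.Nat as ℕ using (_⊔_; s≤s; z≤n)
open import Data.Nat.Properties using (+-identityʳ)
open import Relation.Binary.PropositionalEquality
open import Relation.Nullary using (contradiction)
open import Relation.Nullary.Decidable using (True; toWitness)
open import Data.Unit using (tt)

singleEdge : Graph
singleEdge = record
  { n = 2 ; m = 1 ; edge = λ _ → zero , suc zero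
  ; loopless = λ _ → s≤s z≤n ; noMulti = λ { {zero} {zero} _ → refl } }

halfSplit : LPSol singleEdge
halfSplit = record
  { x = λ _ _ → ½
  ; u = λ { _ zero → 1ℚ ; _ (suc _) → ½ } }

byDecision : ∀ {p q : ℚ} → True (p ≤? q) → p ≤ q
byDecision = toWitness

halfSplit-feasible : Feasible singleEdge halfSplit
halfSplit-feasible = record
  { x-nonneg = λ _ _ → byDecision tt
  ; u-nonneg = λ { _ zero → byDecision tt ; _ (suc zero) → byDecision tt }
  ; slot     = λ { zero → byDecision tt ; (suc zero) → byDecision tt }
  ; cover₁   = λ { zero zero → byDecision tt ; zero (suc zero) → byDecision tt }
  ; cover₂   = λ { zero zero → byDecision tt ; zero (suc zero) → byDecision tt } }

halfSplit-value : lpValue singleEdge halfSplit ≡ + 3 / 2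
halfSplit-value = refl

permutation-injective : ∀ {k} (π : Permutation′ k) {i j} → π ⟨$⟩ʳ i ≡ π ⟨$⟩ʳ j → i ≡ j
permutation-injective π {i} {j} πi≡πj = begin
  i                   ≡⟨ inverseˡ π ⟨
  π ⟨$⟩ˡ (π ⟨$⟩ʳ i)   ≡⟨ cong (π ⟨$⟩ˡ_) πi≡πj ⟩
  π ⟨$⟩ˡ (π ⟨$⟩ʳ j)   ≡⟨ inverseˡ π ⟩
  j                   ∎
  where open ≡-Reasoning

position-max-Fin2 : ∀ {i j : Fin 2} → i ≢ j → ℕ.suc (toℕ i) ⊔ ℕ.suc (toℕ j) ≡ 2
position-max-Fin2 {zero}     {zero}     i≢j = contradiction refl i≢j
position-max-Fin2 {zero}     {suc zero} _   = refl
position-max-Fin2 {suc zero} {zero}     _   = refl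
position-max-Fin2 {suc zero} {suc zero} i≢j = contradiction refl i≢j

singleEdge-cost : (π : Permutation′ 2) → mlvcCost singleEdge π ≡ 2
singleEdge-cost π =
  trans (+-identityʳ _) (position-max-Fin2 (λ πi≡πj → 0≢1 (permutation-injective π πi≡πj)))
  where
  0≢1 : zero ≢ suc zero
  0≢1 ()

proposition5 : (r : ℚ) → r < + 4 / 3 →
    Σ Graph λ G → Σ (LPSol G) λ s → Feasible G s ×
      ((π : Permutation′ (n G)) → r * lpValue G s < fromℕℚ (mlvcCost G π))
proposition5 r r<4/3 = singleEdge , halfSplit , halfSplit-feasible , λ π → begin-strict
  r * lpValue singleEdge halfSplit    ≡⟨ cong (r *_) halfSplit-value ⟩
  r * (+ 3 / 2)                       <⟨ *-monoˡ-<-pos (+ 3 / 2) r<4/3 ⟩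
  + 4 / 3 * (+ 3 / 2)                 ≡⟨⟩
  fromℕℚ 2                            ≡⟨ cong fromℕℚ (sym (singleEdge-cost π)) ⟩
  fromℕℚ (mlvcCost singleEdge π)      ∎
  where open Data.Rational.Properties.≤-Reasoning
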